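{- Let $\mathbf v=\mathbf v_{a_{r_1}b_{r_1}}\cdots\mathbf v_{a_1b_1}$ and $\mathbf v'=\mathbf v_{c_{r_2}d_{r_2}}\cdots\mathbf v_{c_1d_1}$ be compositions of operators with $\mathbf v\equiv\mathbf v'\not\equiv\mathbf 0$. Then $r_1=r_2$.
   Context: For a positive integer $N$, $[N]=\{1,\dots,N\}$, $S_N$ is the symmetric group on $[N]$, $s_{ab}$ is the transposition exchanging $a$ and $b$, and $\ell(w)$ is the number of inversions. Let $q_1,\dots,q_{N-1}$ be commuting indeterminates; $\mathbf q^\alpha=\prod_i q_i^{\alpha_i}$ for $\alpha\in\mathbb Z_{\ge0}^{N-1}$, and $\mathbf q_{ij}=q_i\cdots q_{j-1}$ for $i<j$. $S_N[\mathbf q]=\{\mathbf q^\alpha w: w\in S_N\}$ with $\ell(\mathbf q^\alpha w)=\ell(w)+2\deg\mathbf q^\alpha$. For $k\in[N-1]$ the quantum $k$-Bruhat order has covers: for $w\in S_N$, $i\le k<j$, $w\lessdot_k ws_{ij}$ if $\ell(ws_{ij})=\ell(w)+1$, $w\lessdot_k\mathbf q_{ij}ws_{ij}$ if $\ell(\mathbf q_{ij}ws_{ij})=\ell(w)+1$, extended $\mathbf q$-multiplicatively. Operators $\mathbf v_{ab}$ ($a\ne b$ positive integers) generate a free monoid; a composition $\mathbf v_{a_rb_r}\cdots\mathbf v_{a_1b_1}$ has support $\{a_1,b_1,\dots,a_r,b_r\}$; $\mathbf 0$ is a zero element. For support in $[N]$ and $k\in[N-1]$, the action on $S_N[\mathbf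 q]\cup\{0\}$ is: for $u\in S_N$, $\mathbf v_{ab}\bullet_ku=s_{ab}u$ if $a<b$ and $u\lessdot_k s_{ab}u$; $=\mathbf q_{ij}s_{ab}u$ if $a>b$, $i=u^{ -1}(a)$, $j=u^{ -1}(b)$, and $u\lessdot_k\mathbf q_{ij}s_{ab}u$; $=0$ otherwise; extended by $\mathbf v\bullet_k(\mathbf q^\alpha u)=\mathbf q^\alpha(\mathbf v\bullet_ku)$, $\bullet_k0=0$, and compositions act by applying the rightmost operator first. $\mathbf v\equiv\mathbf v'$ means $\mathbf v\bullet_kx=\mathbf v'\bullet_kx$ for all $N$ containing both supports in $[N]$, all $x\in S_N[\mathbf q]$, all $k\in[N-1]$; $\mathbf v\equiv\mathbf 0$ means the action is always $0$. -}

module Defs where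

open import Data.Nat using (ℕ; zero; suc; _+_; _*_; _∸_; _≤_; _<ᵇ_; _≤ᵇ_; _≡ᵇ_)
open import Data.Bool using (Bool; true; false; if_then_else_; _∧_; _∨_)
open import Data.List using (List; []; _∷_; map; applyUpTo; length)
open import Data.Nat.ListAction using (sum)
open import Data.Bool.ListAction using (any)
open import Data.List.Relation.Unary.All using (All)
open import Data.List.Relation.Binary.Permutation.Propositional using (_↭_)
open import Data.Vec using (Vec; toList; tabulate; zipWith; replicate)
import Data.Vec as V
open import Data.Fin using (toℕ)
open import Data.Maybe using (Maybe; just; nothing)
import Data.Maybe as M
open import Data.Product using (_×_; _,_)
open import Relation.Binary.PropositionalEquality using (_≡_; _≢_)

-- A permutation w ∈ S_N is stored in one-line notation as a vector
-- (w(1), …, w(N)) of natural numbers; positions and values are 1-based.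
-- An element q^α w of S_N[q] (with N = suc n) is a pair (α , w) with
-- α : Vec ℕ n the exponent vector of q_1 … q_{N-1}.

IsPerm : ∀ {N} → Vec ℕ N → Set
IsPerm {N} w = toList w ↭ applyUpTo suc N

-- 1-based lookup (0 if out of range)
nth : List ℕ → ℕ → ℕ
nth []       _             = 0
nth (x ∷ xs) 0             = 0
nth (x ∷ xs) 1             = x
nth (x ∷ xs) (suc (suc i)) = nth xs (suc i)

-- 1-based position of a value (0 if absent), i.e. w⁻¹(a)
pos : List ℕ → ℕ → ℕ
pos []       a = 0
pos (x ∷ xs) a = if x ≡ᵇ a then 1 else (if pos xs a ≡ᵇ 0 then 0 else suc (pos xs a))

at : ∀ {N} → Vec ℕ N → ℕ → ℕ
at w i = nth (toList w) i

inv⁻¹ : ∀ {N} → Vec ℕ N → ℕ → ℕ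
inv⁻¹ w a = pos (toList w) a

invL : List ℕ → ℕ
invL []       = 0
invL (x ∷ xs) = sum (map (λ y → if y <ᵇ x then 1 else 0) xs) + invL xs

ℓ : ∀ {N} → Vec ℕ N → ℕ
ℓ w = invL (toList w)

-- w s_{ij} : swap the entries in positions i and j
swapPos : ∀ {N} → ℕ → ℕ → Vec ℕ N → Vec ℕ N
swapPos i j w = tabulate λ p →
  let t = suc (toℕ p) in
  if t ≡ᵇ i then at w j else (if t ≡ᵇ j then at w i else at w t)

-- s_{ab} u : swap the values a and b
swapVal : ∀ {N} → ℕ → ℕ → Vec ℕ N → Vec ℕ N
swapVal a b = V.map λ x → if x ≡ᵇ a then b else (if x ≡ᵇ b then a else x)

-- exponent vector of q_{ij} = q_i ⋯ q_{j-1}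
qExp : ∀ {n} → ℕ → ℕ → Vec ℕ n
qExp i j = tabulate λ m → let t = suc (toℕ m) in if (i ≤ᵇ t) ∧ (t <ᵇ j) then 1 else 0

_+q_ : ∀ {n} → Vec ℕ n → Vec ℕ n → Vec ℕ n
_+q_ = zipWith _+_

eqV : ∀ {m} → Vec ℕ m → Vec ℕ m → Bool
eqV V.[] V.[] = true
eqV (x V.∷ xs) (y V.∷ ys) = (x ≡ᵇ y) ∧ eqV xs ys

SNq : ℕ → Set
SNq n = Vec ℕ n × Vec ℕ (suc n)

covers : ∀ {n} → ℕ → SNq n → SNq n → Bool
covers {n} k (α , w) (β , y) =
  any (λ i → any (λ j →
      let ws = swapPos i j w in
      eqV y ws ∧
      ((eqV β α ∧ (ℓ ws ≡ᵇ suc (ℓ w)))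
       ∨ (eqV β (α +q qExp i j) ∧ ((ℓ ws + 2 * (j ∸ i)) ≡ᵇ suc (ℓ w)))))
    (applyUpTo (λ t → suc k + t) (suc n ∸ k)))
  (applyUpTo suc k)

-- An operator v_{ab} is the pair (a , b).  Result "nothing" is 0.
-- Action of v_{ab} on u ∈ S_N (no q-factor):
stepPerm : ∀ {n} → ℕ → ℕ × ℕ → Vec ℕ (suc n) → Maybe (SNq n)
stepPerm {n} k (a , b) u =
  if a <ᵇ b then
    (let y = swapVal a b u in
     if covers k (replicate n 0 , u) (replicate n 0 , y) then just (replicate n 0 , y) else nothing)
  else (if b <ᵇ a then
    (let i = inv⁻¹ u a ; j = inv⁻¹ u b ; y = swapVal a b u ; β = qExp i j in
     -- q_{ij} is only defined for i < j; when i > j no cover is possible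
     if (i <ᵇ j) ∧ covers k (replicate n 0 , u) (β , y) then just (β , y) else nothing)
  else nothing)

step : ∀ {n} → ℕ → ℕ × ℕ → Maybe (SNq n) → Maybe (SNq n)
step k ab nothing        = nothing
step k ab (just (α , u)) = M.map (λ { (β , y) → (α +q β , y) }) (stepPerm k ab u)

-- A composition v_{a_r b_r} ⋯ v_{a_1 b_1} is the list
-- (a_r , b_r) ∷ … ∷ (a_1 , b_1) ∷ [] ; the rightmost factor acts first.
Op : Set
Op = List (ℕ × ℕ)

act : ∀ {n} → ℕ → Op → Maybe (SNq n) → Maybe (SNq n)
act k []        x = x
act k (ab ∷ vs) x = step k ab (act k vs x)

WellFormed : Op → Set
WellFormed = All (λ { (a , b) → (1 ≤ a) × (1 ≤ b) × (a ≢ b) })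

SuppIn : ℕ → Op → Set
SuppIn N = All (λ { (a , b) → (a ≤ N) × (b ≤ N) })

_≋_ : Op → Op → Set
v ≋ v' = ∀ (n : ℕ) → SuppIn (suc n) v → SuppIn (suc n) v' →
         ∀ (α : Vec ℕ n) (w : Vec ℕ (suc n)) → IsPerm w →
         ∀ (k : ℕ) → 1 ≤ k → k ≤ n →
         act k v (just (α , w)) ≡ act k v' (just (α , w))

IsZeroOp : Op → Set
IsZeroOp v = ∀ (n : ℕ) → SuppIn (suc n) v →
         ∀ (α : Vec ℕ n) (w : Vec ℕ (suc n)) → IsPerm w →
         ∀ (k : ℕ) → 1 ≤ k → k ≤ n →
         act k v (just (α , w)) ≡ nothing

module Submission where

-- Every quantum k-Bruhat cover raises the grade ℓ(w) + 2 deg q^α by exactly one, so a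
-- composition of r operators either kills x or raises its grade by r; two equivalent
-- compositions acting nontrivially on the same x therefore have the same length.
-- Since lengths are comparable decidably, it suffices to show that v ≡ 0 when the
-- lengths differ.  A nonzero value of v is only available in an S_N containing the
-- support of v, which need not contain that of v'.  Appending the fixed point N + 1
-- embeds S_N[q] into S_{N+1}[q] compatibly with the action of operators supported in
-- [N], because no cover of an embedded permutation can move N + 1; so vanishing of v
-- on S_{N+1}[q] implies vanishing on S_N[q], and we may climb to an N containing both
-- supports, where the grade argument applies.

open import Defs
open import Data.List using (length)
open import Relation.Binary.PropositionalEquality using (_≡_)
open import Relation.Nullary using (¬_)

open import Data.Bool using (Bool; true; false; if_then_else_; _∧_; _∨_; T)
open import Data.Bool.Properties using (∧-zeroʳ; ∧-identityʳ; ∧-assoc)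
open import Data.Bool.ListAction using (any)
open import Data.Empty using (⊥-elim)
open import Data.Fin using (toℕ)
open import Data.Fin.Properties using (toℕ<n)
open import Data.List as L using ([]; _∷_; _++_; [_]; applyUpTo)
open import Data.List.Properties using (applyUpTo-∷ʳ; map-++)
open import Data.List.Relation.Unary.All using (All; []; _∷_)
open import Data.List.Relation.Unary.All.Properties using (applyUpTo⁺₁)
open import Data.List.Relation.Binary.Permutation.Propositional using (_↭_; ↭-sym)
open import Data.List.Relation.Binary.Permutation.Propositional.Properties using (All-resp-↭; ++⁺ʳ)
open import Data.Maybe as M using (Maybe; just; nothing)
import Data.Maybe.Relation.Unary.All as Maybe
open import Data.Nat using (ℕ; zero; suc; _+_; _*_; _∸_; _⊓_; _⊔_; _≤_; _<_; _<ᵇ_; _≤ᵇ_; _≡ᵇ_; z≤n; s≤s; z<s; s<s)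
open import Data.Nat.Properties
open import Algebra.Properties.CommutativeSemigroup +-commutativeSemigroup using (interchange)
open import Data.Nat.ListAction using (sum)
open import Data.Nat.ListAction.Properties using (sum-++)
open import Data.Nat.Tactic.RingSolver using (solve-∀)
open import Data.Product using (Σ; _×_; _,_; proj₁; proj₂)
open import Data.Sum using (_⊎_; inj₁; inj₂)
open import Data.Unit using (tt)
open import Data.Vec as V using (Vec; toList; zipWith; replicate; _∷ʳ_)
open import Data.Vec.Properties using (map-∷ʳ; length-toList; toList-∷ʳ; tabulate-cong)
import Data.Vec.Relation.Unary.All as VecAll
open import Data.Vec.Relation.Unary.All.Properties using (map⁺; tabulate⁺; toList⁺; toList⁻)
open import Function using (_∘_)
open import Relation.Binary.PropositionalEquality using (_≢_; refl; sym; trans; cong; cong₂; subst; subst₂; module ≡-Reasoning)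
open import Relation.Nullary.Decidable using (yes; no; decidable-stable)

private
  variable
    n : ℕ

T⇒≡true : ∀ {x} → T x → x ≡ true
T⇒≡true {true} _ = refl

≡true⇒T : ∀ {x} → x ≡ true → T x
≡true⇒T refl = tt

¬T⇒≡false : ∀ {x} → ¬ T x → x ≡ false
¬T⇒≡false {false} _ = refl
¬T⇒≡false {true} ¬t = ⊥-elim (¬t tt)

∧≡true⇒ : ∀ {x y} → (x ∧ y) ≡ true → x ≡ true × y ≡ true
∧≡true⇒ {true} {true} _ = refl , refl

∨≡true⇒ : ∀ {x y} → (x ∨ y) ≡ true → x ≡ true ⊎ y ≡ true
∨≡true⇒ {true} _ = inj₁ refl
∨≡true⇒ {false} e = inj₂ e

<⇒<ᵇ≡true : ∀ {m n} → m < n → (m <ᵇ n) ≡ true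
<⇒<ᵇ≡true = T⇒≡true ∘ <⇒<ᵇ

≤⇒≤ᵇ≡true : ∀ {m n} → m ≤ n → (m ≤ᵇ n) ≡ true
≤⇒≤ᵇ≡true = T⇒≡true ∘ ≤⇒≤ᵇ

≥⇒<ᵇ≡false : ∀ {m n} → n ≤ m → (m <ᵇ n) ≡ false
≥⇒<ᵇ≡false {m} {n} n≤m = ¬T⇒≡false (λ t → <⇒≱ (<ᵇ⇒< m n t) n≤m)

>⇒≤ᵇ≡false : ∀ {m n} → n < m → (m ≤ᵇ n) ≡ false
>⇒≤ᵇ≡false {m} {n} n<m = ¬T⇒≡false (λ t → <⇒≱ n<m (≤ᵇ⇒≤ m n t))

≢⇒≡ᵇ≡false : ∀ {m n} → m ≢ n → (m ≡ᵇ n) ≡ false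
≢⇒≡ᵇ≡false {m} {n} m≢n = ¬T⇒≡false (m≢n ∘ ≡ᵇ⇒≡ m n)

≡ᵇ≡true⇒≡ : ∀ {m n} → (m ≡ᵇ n) ≡ true → m ≡ n
≡ᵇ≡true⇒≡ {m} {n} = ≡ᵇ⇒≡ m n ∘ ≡true⇒T

≡ᵇ-refl : ∀ m → (m ≡ᵇ m) ≡ true
≡ᵇ-refl m = T⇒≡true (≡⇒≡ᵇ m m refl)

m<n∸o⇒o+m<n : ∀ {m n o} → m < n ∸ o → o + m < n
m<n∸o⇒o+m<n {m} {n} {o} m<n∸o = subst (_≤ n) (cong suc (+-comm m o)) (m≤o∸n⇒m+n≤o (suc m) o≤n m<n∸o)
  where
  o≤n : o ≤ n
  o≤n = <⇒≤ (m∸n≢0⇒n<m (λ n∸o≡0 → <⇒≱ m<n∸o (subst (_≤ m) (sym n∸o≡0) z≤n)))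

any-applyUpTo⇒ : ∀ (p : ℕ → Bool) f m → any p (applyUpTo f m) ≡ true →
                 Σ ℕ λ t → t < m × p (f t) ≡ true
any-applyUpTo⇒ p f (suc m) e with p (f 0) in p₀
... | true = 0 , z<s , p₀
... | false with any-applyUpTo⇒ p (f ∘ suc) m e
...   | t , t<m , pt = suc t , s<s t<m , pt

any-applyUpTo-cong : ∀ (p q : ℕ → Bool) f m → (∀ t → t < m → p (f t) ≡ q (f t)) →
                     any p (applyUpTo f m) ≡ any q (applyUpTo f m)
any-applyUpTo-cong p q f zero    p≡q = refl
any-applyUpTo-cong p q f (suc m) p≡q =
  cong₂ _∨_ (p≡q 0 z<s) (any-applyUpTo-cong p q (f ∘ suc) m (λ t t<m → p≡q (suc t) (s<s t<m)))

any-applyUpTo-∷ʳ-false : ∀ (p q : ℕ → Bool) f m → (∀ t → t < m → p (f t) ≡ q (f t)) →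
                         p (f m) ≡ false → any p (applyUpTo f (suc m)) ≡ any q (applyUpTo f m)
any-applyUpTo-∷ʳ-false p q f zero    p≡q pm = cong (_∨ false) pm
any-applyUpTo-∷ʳ-false p q f (suc m) p≡q pm =
  cong₂ _∨_ (p≡q 0 z<s) (any-applyUpTo-∷ʳ-false p q (f ∘ suc) m (λ t t<m → p≡q (suc t) (s<s t<m)) pm)

tabulate-1+toℕ-∷ʳ : ∀ {A : Set} {n} (g : ℕ → A) →
  V.tabulate {suc n} (λ p → g (suc (toℕ p))) ≡ V.tabulate {n} (λ p → g (suc (toℕ p))) ∷ʳ g (suc n)
tabulate-1+toℕ-∷ʳ {n = zero}  g = refl
tabulate-1+toℕ-∷ʳ {n = suc n} g = cong (g 1 V.∷_) (tabulate-1+toℕ-∷ʳ (g ∘ suc))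

zipWith-∷ʳ : ∀ {A B C : Set} {n} (f : A → B → C) (xs : Vec A n) (ys : Vec B n) x y →
             zipWith f (xs ∷ʳ x) (ys ∷ʳ y) ≡ zipWith f xs ys ∷ʳ f x y
zipWith-∷ʳ f V.[]       V.[]       x y = refl
zipWith-∷ʳ f (a V.∷ xs) (b V.∷ ys) x y = cong (f a b V.∷_) (zipWith-∷ʳ f xs ys x y)

replicate-∷ʳ : ∀ {A : Set} n (x : A) → replicate (suc n) x ≡ replicate n x ∷ʳ x
replicate-∷ʳ zero    x = refl
replicate-∷ʳ (suc n) x = cong (x V.∷_) (replicate-∷ʳ n x)

eqV-∷ʳ : ∀ {n} (xs ys : Vec ℕ n) x y → eqV (xs ∷ʳ x) (ys ∷ʳ y) ≡ (eqV xs ys ∧ (x ≡ᵇ y))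
eqV-∷ʳ V.[]       V.[]       x y = ∧-identityʳ (x ≡ᵇ y)
eqV-∷ʳ (a V.∷ xs) (b V.∷ ys) x y =
  trans (cong ((a ≡ᵇ b) ∧_) (eqV-∷ʳ xs ys x y)) (sym (∧-assoc (a ≡ᵇ b) _ _))

eqV-∷ʳ-same : ∀ {n} (xs ys : Vec ℕ n) x → eqV (xs ∷ʳ x) (ys ∷ʳ x) ≡ eqV xs ys
eqV-∷ʳ-same xs ys x = trans (eqV-∷ʳ xs ys x x) (trans (cong (eqV xs ys ∧_) (≡ᵇ-refl x)) (∧-identityʳ _))

eqV⇒≡ : ∀ {n} (xs ys : Vec ℕ n) → eqV xs ys ≡ true → xs ≡ ys
eqV⇒≡ V.[]       V.[]       _ = refl
eqV⇒≡ (a V.∷ xs) (b V.∷ ys) e with ∧≡true⇒ {a ≡ᵇ b} e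
... | a≡b , xs≡ys = cong₂ V._∷_ (≡ᵇ≡true⇒≡ a≡b) (eqV⇒≡ xs ys xs≡ys)

nth-All : ∀ {P : ℕ → Set} {xs} → All P xs → P 0 → ∀ t → P (nth xs t)
nth-All []         p₀ t             = p₀
nth-All (px ∷ pxs) p₀ zero          = p₀
nth-All (px ∷ pxs) p₀ (suc zero)    = px
nth-All (px ∷ pxs) p₀ (suc (suc t)) = nth-All pxs p₀ (suc t)

nth-++-inside : ∀ xs m t → t ≤ length xs → nth (xs ++ [ m ]) t ≡ nth xs t
nth-++-inside []       m zero          _         = refl
nth-++-inside (x ∷ xs) m zero          _         = refl
nth-++-inside (x ∷ xs) m (suc zero)    _         = refl
nth-++-inside (x ∷ xs) m (suc (suc t)) (s≤s t≤) = nth-++-inside xs m (suc t) t≤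

nth-++-last : ∀ xs m → nth (xs ++ [ m ]) (suc (length xs)) ≡ m
nth-++-last []       m = refl
nth-++-last (x ∷ xs) m = nth-++-last xs m

pos-++-other : ∀ xs m a → m ≢ a → pos (xs ++ [ m ]) a ≡ pos xs a
pos-++-other []       m a m≢a rewrite ≢⇒≡ᵇ≡false m≢a = refl
pos-++-other (x ∷ xs) m a m≢a rewrite pos-++-other xs m a m≢a = refl

pos≤length : ∀ xs a → pos xs a ≤ length xs
pos≤length []       a = z≤n
pos≤length (x ∷ xs) a with x ≡ᵇ a
... | true = s≤s z≤n
... | false with pos xs a ≡ᵇ 0
...   | true  = z≤n
...   | false = s≤s (pos≤length xs a)

invL-++-max : ∀ xs m → All (_≤ m) xs → invL (xs ++ [ m ]) ≡ invL xs
invL-++-max []       m _            = refl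
invL-++-max (x ∷ xs) m (x≤m ∷ xs≤m) = cong₂ _+_ noNewInversion (invL-++-max xs m xs≤m)
  where
  open ≡-Reasoning
  below : ℕ → ℕ
  below y = if y <ᵇ x then 1 else 0
  m-not-below : below m ≡ 0
  m-not-below rewrite ≥⇒<ᵇ≡false x≤m = refl
  noNewInversion : sum (L.map below (xs ++ [ m ])) ≡ sum (L.map below xs)
  noNewInversion = begin
    sum (L.map below (xs ++ [ m ]))       ≡⟨ cong sum (map-++ below xs [ m ]) ⟩
    sum (L.map below xs ++ [ below m ])   ≡⟨ sum-++ (L.map below xs) [ below m ] ⟩
    sum (L.map below xs) + (below m + 0)  ≡⟨ cong (λ c → sum (L.map below xs) + (c + 0)) m-not-below ⟩
    sum (L.map below xs) + 0              ≡⟨ +-identityʳ _ ⟩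
    sum (L.map below xs)                  ∎

-- The grade ℓ(w) + 2 deg q^α

grade : SNq n → ℕ
grade (α , w) = ℓ w + 2 * V.sum α

sum-∷ʳ : ∀ {n} (xs : Vec ℕ n) x → V.sum (xs ∷ʳ x) ≡ V.sum xs + x
sum-∷ʳ V.[]       x = +-identityʳ x
sum-∷ʳ (y V.∷ xs) x = trans (cong (y +_) (sum-∷ʳ xs x)) (sym (+-assoc y _ x))

sum-zipWith-+ : ∀ {n} (xs ys : Vec ℕ n) → V.sum (zipWith _+_ xs ys) ≡ V.sum xs + V.sum ys
sum-zipWith-+ V.[]       V.[]       = refl
sum-zipWith-+ (x V.∷ xs) (y V.∷ ys) =
  trans (cong (x + y +_) (sum-zipWith-+ xs ys)) (interchange x y (V.sum xs) (V.sum ys))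

sum-replicate-0 : ∀ n → V.sum (replicate n 0) ≡ 0
sum-replicate-0 zero    = refl
sum-replicate-0 (suc n) = sum-replicate-0 n

grade-+q : ∀ {n} (α β : Vec ℕ n) y → grade (α +q β , y) ≡ grade (β , y) + 2 * V.sum α
grade-+q α β y = trans (cong (λ s → ℓ y + 2 * s) (sum-zipWith-+ α β)) (rearrange (ℓ y) (V.sum α) (V.sum β))
  where
  rearrange : ∀ l s t → l + 2 * (s + t) ≡ l + 2 * t + 2 * s
  rearrange = solve-∀

grade-replicate-0 : ∀ {n} (w : Vec ℕ (suc n)) → grade (replicate n 0 , w) ≡ ℓ w
grade-replicate-0 {n} w = trans (cong (λ s → ℓ w + 2 * s) (sum-replicate-0 n)) (+-identityʳ (ℓ w))

qExpEntry : ℕ → ℕ → ℕ → ℕ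
qExpEntry i j t = if (i ≤ᵇ t) ∧ (t <ᵇ j) then 1 else 0

qExp-∷ʳ : ∀ {n} i j → qExp {suc n} i j ≡ qExp {n} i j ∷ʳ qExpEntry i j (suc n)
qExp-∷ʳ i j = tabulate-1+toℕ-∷ʳ (qExpEntry i j)

qExpEntry-≥ : ∀ i {j t} → j ≤ t → qExpEntry i j t ≡ 0
qExpEntry-≥ i {j} {t} j≤t rewrite ≥⇒<ᵇ≡false j≤t | ∧-zeroʳ (i ≤ᵇ t) = refl

∸-+-indicator : ∀ i N → N ∸ i + (if i ≤ᵇ N then 1 else 0) ≡ suc N ∸ i
∸-+-indicator i N with i ≤? N
... | yes i≤N rewrite ≤⇒≤ᵇ≡true i≤N = trans (+-comm (N ∸ i) 1) (sym (+-∸-assoc 1 i≤N))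
... | no  i≰N rewrite >⇒≤ᵇ≡false (≰⇒> i≰N) =
  trans (+-identityʳ _) (trans (m≤n⇒m∸n≡0 (<⇒≤ (≰⇒> i≰N))) (sym (m≤n⇒m∸n≡0 (≰⇒> i≰N))))

⊓-∸-+-qExpEntry : ∀ i j N → (j ⊓ N) ∸ i + qExpEntry i j N ≡ (j ⊓ suc N) ∸ i
⊓-∸-+-qExpEntry i j N with N <? j
... | yes N<j rewrite m≥n⇒m⊓n≡n (<⇒≤ N<j) | m≥n⇒m⊓n≡n N<j | <⇒<ᵇ≡true N<j | ∧-identityʳ (i ≤ᵇ N) =
  ∸-+-indicator i N
... | no  N≮j rewrite m≤n⇒m⊓n≡m (≮⇒≥ N≮j) | m≤n⇒m⊓n≡m (m≤n⇒m≤1+n (≮⇒≥ N≮j)) | qExpEntry-≥ i (≮⇒≥ N≮j) =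
  +-identityʳ _

-- Capping j at n + 1 makes the formula valid for every j, as the induction on n needs.
sum-qExp : ∀ {n} i j → 1 ≤ i → V.sum (qExp {n} i j) ≡ (j ⊓ suc n) ∸ i
sum-qExp {zero}  i j 1≤i = sym (m≤n⇒m∸n≡0 (≤-trans (m⊓n≤n j 1) 1≤i))
sum-qExp {suc n} i j 1≤i = begin
  V.sum (qExp {suc n} i j)                            ≡⟨ cong V.sum (qExp-∷ʳ {n} i j) ⟩
  V.sum (qExp {n} i j ∷ʳ qExpEntry i j (suc n))       ≡⟨ sum-∷ʳ (qExp {n} i j) _ ⟩
  V.sum (qExp {n} i j) + qExpEntry i j (suc n)        ≡⟨ cong (_+ qExpEntry i j (suc n)) (sum-qExp i j 1≤i) ⟩
  (j ⊓ suc n) ∸ i + qExpEntry i j (suc n)             ≡⟨ ⊓-∸-+-qExpEntry i j (suc n) ⟩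
  (j ⊓ suc (suc n)) ∸ i                               ∎
  where open ≡-Reasoning

-- Covers raise the grade by one

-- covers k x y unfolds definitionally to the disjunction of coversAt x y i j over i ≤ k < j ≤ N;
-- coverTest names the individual tests so that they can be transported one at a time.
coverTest : Bool → Bool → Bool → ℕ → ℕ → ℕ → Bool
coverTest y≟ws β≟α β≟αq ℓws ℓw d =
  y≟ws ∧ ((β≟α ∧ (ℓws ≡ᵇ suc ℓw)) ∨ (β≟αq ∧ ((ℓws + 2 * d) ≡ᵇ suc ℓw)))

coversAt : SNq n → SNq n → ℕ → ℕ → Bool
coversAt (α , w) (β , y) i j =
  coverTest (eqV y (swapPos i j w)) (eqV β α) (eqV β (α +q qExp i j)) (ℓ (swapPos i j w)) (ℓ w) (j ∸ i)

covers⇒coversAt : ∀ {n} k (x y : SNq n) → covers k x y ≡ true →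
  Σ ℕ λ i → Σ ℕ λ j → 1 ≤ i × j ≤ suc n × coversAt x y i j ≡ true
covers⇒coversAt {n} k x y c with any-applyUpTo⇒ _ suc k c
... | t , _ , c′ with any-applyUpTo⇒ _ (suc k +_) (suc n ∸ k) c′
...   | t′ , t′<d , c″ = suc t , suc k + t′ , s≤s z≤n , m<n∸o⇒o+m<n t′<d , c″

coversAt-grade : ∀ {n} (x y : SNq n) i j → 1 ≤ i → j ≤ suc n → coversAt x y i j ≡ true →
                 grade y ≡ suc (grade x)
coversAt-grade {n} (α , w) (β , y) i j 1≤i j≤N c with ∧≡true⇒ {eqV y (swapPos i j w)} c
... | y≡ws , c′ with ∨≡true⇒ c′
...   | inj₁ c₁ with ∧≡true⇒ {eqV β α} c₁
...     | β≡α , ℓ≡ = begin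
  grade (β , y)    ≡⟨ cong₂ (λ (γ : Vec ℕ n) z → grade (γ , z)) (eqV⇒≡ β α β≡α) (eqV⇒≡ y ws y≡ws) ⟩
  ℓ ws + 2Σα       ≡⟨ cong (_+ 2Σα) (≡ᵇ≡true⇒≡ {ℓ ws} ℓ≡) ⟩
  suc (ℓ w) + 2Σα  ∎
  where
  open ≡-Reasoning
  ws = swapPos i j w
  2Σα = 2 * V.sum α
coversAt-grade {n} (α , w) (β , y) i j 1≤i j≤N c | y≡ws , c′ | inj₂ c₂ with ∧≡true⇒ {eqV β _} c₂
...     | β≡ , ℓ≡ = begin
  grade (β , y)                         ≡⟨ cong₂ (λ (γ : Vec ℕ n) z → grade (γ , z)) (eqV⇒≡ β _ β≡) (eqV⇒≡ y ws y≡ws) ⟩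
  grade (α +q qExp i j , ws)            ≡⟨ grade-+q α (qExp {n} i j) ws ⟩
  ℓ ws + 2 * V.sum (qExp {n} i j) + 2Σα ≡⟨ cong (λ s → ℓ ws + 2 * s + 2Σα) sum-qExp-ij ⟩
  ℓ ws + 2 * (j ∸ i) + 2Σα              ≡⟨ cong (_+ 2Σα) (≡ᵇ≡true⇒≡ {ℓ ws + 2 * (j ∸ i)} ℓ≡) ⟩
  suc (ℓ w) + 2Σα                       ∎
  where
  open ≡-Reasoning
  ws = swapPos i j w
  2Σα = 2 * V.sum α
  sum-qExp-ij : V.sum (qExp {n} i j) ≡ j ∸ i
  sum-qExp-ij = trans (sum-qExp i j 1≤i) (cong (_∸ i) (m≤n⇒m⊓n≡m j≤N))

covers-grade : ∀ {n} k (x y : SNq n) → covers k x y ≡ true → grade y ≡ suc (grade x)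
covers-grade k x y c with covers⇒coversAt k x y c
... | i , j , 1≤i , j≤N , c′ = coversAt-grade x y i j 1≤i j≤N c′

stepPerm-just : ∀ {n} k a b (u : Vec ℕ (suc n)) {x} → stepPerm k (a , b) u ≡ just x →
                proj₂ x ≡ swapVal a b u × covers k (replicate n 0 , u) x ≡ true
stepPerm-just {n} k a b u e with a <ᵇ b
... | true with covers k (replicate n 0 , u) (replicate n 0 , swapVal a b u) in c
...   | true with refl ← e = refl , c
...   | false with () ← e
stepPerm-just {n} k a b u e | false with b <ᵇ a
... | false with () ← e
... | true with inv⁻¹ u a <ᵇ inv⁻¹ u b
...   | false with () ← e
...   | true with covers k (replicate n 0 , u) (qExp (inv⁻¹ u a) (inv⁻¹ u b) , swapVal a b u) in c
...     | true with refl ← e = refl , c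
...     | false with () ← e

step-grade : ∀ {n} k ab (x x′ : SNq n) → step k ab (just x) ≡ just x′ → grade x′ ≡ suc (grade x)
step-grade k (a , b) (α , u) x′ e with stepPerm k (a , b) u in stepped
... | nothing with () ← e
... | just (β , y) with refl ← e = trans (grade-+q α β y) (cong (_+ 2 * V.sum α) cover)
  where
  cover : grade (β , y) ≡ suc (ℓ u)
  cover = trans (covers-grade k (replicate _ 0 , u) (β , y) (proj₂ (stepPerm-just k a b u stepped)))
                (cong suc (grade-replicate-0 u))

act-grade : ∀ {n} k v (x x′ : SNq n) → act k v (just x) ≡ just x′ → grade x′ ≡ length v + grade x
act-grade k []       x x′ refl = refl
act-grade k (ab ∷ v) x x′ e with act k v (just x) in acted
... | nothing with () ← e
... | just x₁ = trans (step-grade k ab x₁ x′ e) (cong suc (act-grade k v x x₁ acted))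

-- Embedding S_N[q] into S_{N+1}[q]

Bounded : ℕ → Vec ℕ n → Set
Bounded N = VecAll.All (_≤ N)

IsPerm⇒Bounded : ∀ {N} (w : Vec ℕ N) → IsPerm w → Bounded N w
IsPerm⇒Bounded {N} w w↭ = toList⁻ (All-resp-↭ (↭-sym w↭) (applyUpTo⁺₁ suc N (λ t<N → t<N)))

IsPerm-∷ʳ : ∀ {N} (w : Vec ℕ N) → IsPerm w → IsPerm (w ∷ʳ suc N)
IsPerm-∷ʳ {N} w w↭ = subst₂ _↭_ (sym (toList-∷ʳ (suc N) w)) (applyUpTo-∷ʳ suc N) (++⁺ʳ [ suc N ] w↭)

at-bounded : ∀ {N} {w : Vec ℕ N} → Bounded N w → ∀ t → at w t ≤ N
at-bounded w≤N = nth-All (toList⁺ w≤N) z≤n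

at-∷ʳ : ∀ {N} (w : Vec ℕ N) m t → t ≤ N → at (w ∷ʳ m) t ≡ at w t
at-∷ʳ {N} w m t t≤N rewrite toList-∷ʳ m w =
  nth-++-inside (toList w) m t (subst (t ≤_) (sym (length-toList w)) t≤N)

at-∷ʳ-last : ∀ {N} (w : Vec ℕ N) m → at (w ∷ʳ m) (suc N) ≡ m
at-∷ʳ-last {N} w m rewrite toList-∷ʳ m w =
  subst (λ l → nth (toList w ++ [ m ]) (suc l) ≡ m) (length-toList w) (nth-++-last (toList w) m)

inv⁻¹-∷ʳ : ∀ {N} (w : Vec ℕ N) m a → m ≢ a → inv⁻¹ (w ∷ʳ m) a ≡ inv⁻¹ w a
inv⁻¹-∷ʳ w m a m≢a = trans (cong (λ xs → pos xs a) (toList-∷ʳ m w)) (pos-++-other (toList w) m a m≢a)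

inv⁻¹≤ : ∀ {N} (w : Vec ℕ N) a → inv⁻¹ w a ≤ N
inv⁻¹≤ w a = subst (inv⁻¹ w a ≤_) (length-toList w) (pos≤length (toList w) a)

ℓ-∷ʳ : ∀ {N} (w : Vec ℕ N) m → Bounded m w → ℓ (w ∷ʳ m) ≡ ℓ w
ℓ-∷ʳ w m w≤m rewrite toList-∷ʳ m w = invL-++-max (toList w) m (toList⁺ w≤m)

swapAt : (ℕ → ℕ) → ℕ → ℕ → ℕ → ℕ
swapAt g i j t = if t ≡ᵇ i then g j else (if t ≡ᵇ j then g i else g t)

swapAt-cong : ∀ {N} {g h : ℕ → ℕ} {i j t} → (∀ x → x ≤ N → g x ≡ h x) → i ≤ N → j ≤ N → t ≤ N →
              swapAt g i j t ≡ swapAt h i j t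
swapAt-cong g≡h i≤N j≤N t≤N rewrite g≡h _ i≤N | g≡h _ j≤N | g≡h _ t≤N = refl

swapAt-other : ∀ g {i j t} → t ≢ i → t ≢ j → swapAt g i j t ≡ g t
swapAt-other g t≢i t≢j rewrite ≢⇒≡ᵇ≡false t≢i | ≢⇒≡ᵇ≡false t≢j = refl

swapAt-snd : ∀ g {i j} → j ≢ i → swapAt g i j j ≡ g i
swapAt-snd g {i} {j} j≢i rewrite ≢⇒≡ᵇ≡false j≢i | ≡ᵇ-refl j = refl

swapAt-pres : ∀ {P : ℕ → Set} g i j t → (∀ x → P (g x)) → P (swapAt g i j t)
swapAt-pres g i j t Pg with t ≡ᵇ i
... | true = Pg j
... | false with t ≡ᵇ j
...   | true  = Pg i
...   | false = Pg t

swapPos-bounded : ∀ {N} i j {w : Vec ℕ N} → Bounded N w → Bounded N (swapPos i j w)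
swapPos-bounded {N} i j {w} w≤N = tabulate⁺ (λ p → swapAt-pres {_≤ N} (at w) i j (suc (toℕ p)) (at-bounded w≤N))

swapPos-∷ʳ : ∀ {N} i j (w : Vec ℕ N) m → i ≤ N → j ≤ N → swapPos i j (w ∷ʳ m) ≡ swapPos i j w ∷ʳ m
swapPos-∷ʳ {N} i j w m i≤N j≤N =
  trans (tabulate-1+toℕ-∷ʳ (swapAt (at (w ∷ʳ m)) i j)) (cong₂ _∷ʳ_ (tabulate-cong old) new)
  where
  old : ∀ p → swapAt (at (w ∷ʳ m)) i j (suc (toℕ p)) ≡ swapAt (at w) i j (suc (toℕ p))
  old p = swapAt-cong (at-∷ʳ w m) i≤N j≤N (toℕ<n p)
  new : swapAt (at (w ∷ʳ m)) i j (suc N) ≡ m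
  new = trans (swapAt-other _ (>⇒≢ (s≤s i≤N)) (>⇒≢ (s≤s j≤N))) (at-∷ʳ-last w m)

swapVal-∷ʳ : ∀ {N} a b (w : Vec ℕ N) m → m ≢ a → m ≢ b → swapVal a b (w ∷ʳ m) ≡ swapVal a b w ∷ʳ m
swapVal-∷ʳ a b w m m≢a m≢b rewrite map-∷ʳ (λ x → if x ≡ᵇ a then b else (if x ≡ᵇ b then a else x)) m w
                                  | ≢⇒≡ᵇ≡false m≢a | ≢⇒≡ᵇ≡false m≢b = refl

swapVal-bounded : ∀ {N} a b {w : Vec ℕ N} → a ≤ N → b ≤ N → Bounded N w → Bounded N (swapVal a b w)
swapVal-bounded {N} a b a≤N b≤N w≤N = map⁺ (VecAll.map swap≤ w≤N)
  where
  swap≤ : ∀ {x} → x ≤ N → (if x ≡ᵇ a then b else (if x ≡ᵇ b then a else x)) ≤ N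
  swap≤ {x} x≤N with x ≡ᵇ a
  ... | true = b≤N
  ... | false with x ≡ᵇ b
  ...   | true  = a≤N
  ...   | false = x≤N

embed : SNq n → SNq (suc n)
embed {n} (α , w) = α ∷ʳ 0 , w ∷ʳ suc (suc n)

+q-qExp-∷ʳ : ∀ {n} (α : Vec ℕ n) i {j} → j ≤ suc n → (α ∷ʳ 0) +q qExp {suc n} i j ≡ (α +q qExp i j) ∷ʳ 0
+q-qExp-∷ʳ {n} α i {j} j≤N = begin
  (α ∷ʳ 0) +q qExp {suc n} i j                        ≡⟨ cong ((α ∷ʳ 0) +q_) (qExp-∷ʳ {n} i j) ⟩
  (α ∷ʳ 0) +q (qExp i j ∷ʳ qExpEntry i j (suc n))     ≡⟨ cong (λ e → (α ∷ʳ 0) +q (qExp i j ∷ʳ e)) (qExpEntry-≥ i j≤N) ⟩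
  (α ∷ʳ 0) +q (qExp i j ∷ʳ 0)                         ≡⟨ zipWith-∷ʳ _+_ α (qExp i j) 0 0 ⟩
  (α +q qExp i j) ∷ʳ 0                                ∎
  where open ≡-Reasoning

coversAt-embed : ∀ {n} (α β : Vec ℕ n) (w y : Vec ℕ (suc n)) i j → i ≤ suc n → j ≤ suc n → Bounded (suc n) w →
                 coversAt (embed (α , w)) (embed (β , y)) i j ≡ coversAt (α , w) (β , y) i j
coversAt-embed {n} α β w y i j i≤N j≤N w≤N =
  cong₂ (λ { (t₁ , t₂ , t₃) (l , l′) → coverTest t₁ t₂ t₃ l l′ (j ∸ i) })
        (cong₂ _,_ sameY (cong₂ _,_ (eqV-∷ʳ-same β α 0) sameShift))
        (cong₂ _,_ ℓ-swapped (ℓ-∷ʳ w M (VecAll.map m≤n⇒m≤1+n w≤N)))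
  where
  M = suc (suc n)
  swapped : swapPos i j (w ∷ʳ M) ≡ swapPos i j w ∷ʳ M
  swapped = swapPos-∷ʳ i j w M i≤N j≤N
  sameY : eqV (y ∷ʳ M) (swapPos i j (w ∷ʳ M)) ≡ eqV y (swapPos i j w)
  sameY = trans (cong (eqV (y ∷ʳ M)) swapped) (eqV-∷ʳ-same y (swapPos i j w) M)
  sameShift : eqV (β ∷ʳ 0) ((α ∷ʳ 0) +q qExp i j) ≡ eqV β (α +q qExp i j)
  sameShift = trans (cong (eqV (β ∷ʳ 0)) (+q-qExp-∷ʳ α i j≤N)) (eqV-∷ʳ-same β (α +q qExp i j) 0)
  ℓ-swapped : ℓ (swapPos i j (w ∷ʳ M)) ≡ ℓ (swapPos i j w)
  ℓ-swapped = trans (cong ℓ swapped) (ℓ-∷ʳ (swapPos i j w) M (VecAll.map m≤n⇒m≤1+n (swapPos-bounded i j w≤N)))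

-- A cover by the transposition (i, N + 1) would move the fixed point N + 1.
coversAt-embed-last : ∀ {n} (x y : SNq n) i → i ≤ suc n → Bounded (suc n) (proj₂ x) →
                      coversAt (embed x) (embed y) i (suc (suc n)) ≡ false
coversAt-embed-last {n} (α , w) (β , y) i i≤N w≤N = cong (_∧ _) lastDiffers
  where
  open ≡-Reasoning
  M = suc (suc n)
  g = swapAt (at (w ∷ʳ M)) i M
  moved : g M ≡ at w i
  moved = trans (swapAt-snd (at (w ∷ʳ M)) (>⇒≢ (s≤s i≤N))) (at-∷ʳ w M i i≤N)
  lastDiffers : eqV (y ∷ʳ M) (swapPos i M (w ∷ʳ M)) ≡ false
  lastDiffers = begin
    eqV (y ∷ʳ M) (swapPos i M (w ∷ʳ M))   ≡⟨ cong (eqV (y ∷ʳ M)) (tabulate-1+toℕ-∷ʳ g) ⟩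
    eqV (y ∷ʳ M) (front ∷ʳ g M)            ≡⟨ eqV-∷ʳ y front M (g M) ⟩
    eqV y front ∧ (M ≡ᵇ g M)               ≡⟨ cong (λ z → eqV y front ∧ (M ≡ᵇ z)) moved ⟩
    eqV y front ∧ (M ≡ᵇ at w i)            ≡⟨ cong (eqV y front ∧_) (≢⇒≡ᵇ≡false (>⇒≢ (s≤s (at-bounded w≤N i)))) ⟩
    eqV y front ∧ false                    ≡⟨ ∧-zeroʳ _ ⟩
    false                                  ∎
    where
    front = V.tabulate (λ p → g (suc (toℕ p)))

covers-embed : ∀ {n} k (x y : SNq n) → k ≤ suc n → Bounded (suc n) (proj₂ x) →
               covers k (embed x) (embed y) ≡ covers k x y
covers-embed {n} k x@(α , w) y@(β , y′) k≤N w≤N =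
  any-applyUpTo-cong _ _ suc k (λ t t<k → sameJs (suc t) (≤-trans t<k k≤N))
  where
  open ≡-Reasoning
  d = suc n ∸ k
  sameJs : ∀ i → i ≤ suc n →
           any (coversAt (embed x) (embed y) i) (applyUpTo (suc k +_) (suc (suc n) ∸ k))
           ≡ any (coversAt x y i) (applyUpTo (suc k +_) d)
  sameJs i i≤N = begin
    any (coversAt (embed x) (embed y) i) (applyUpTo (suc k +_) (suc (suc n) ∸ k))
      ≡⟨ cong (λ l → any (coversAt (embed x) (embed y) i) (applyUpTo (suc k +_) l)) (+-∸-assoc 1 k≤N) ⟩
    any (coversAt (embed x) (embed y) i) (applyUpTo (suc k +_) (suc d))
      ≡⟨ any-applyUpTo-∷ʳ-false _ _ (suc k +_) d
           (λ t t<d → coversAt-embed α β w y′ i (suc k + t) i≤N (m<n∸o⇒o+m<n t<d) w≤N)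
           (trans (cong (coversAt (embed x) (embed y) i ∘ suc) (m+[n∸m]≡n k≤N))
                  (coversAt-embed-last x y i i≤N w≤N)) ⟩
    any (coversAt x y i) (applyUpTo (suc k +_) d)
      ∎

if-just-embed : ∀ {n} {c′ c} {r′ : SNq (suc n)} {r : SNq n} → c′ ≡ c → r′ ≡ embed r →
                (if c′ then just r′ else nothing) ≡ M.map embed (if c then just r else nothing)
if-just-embed {c = true}  refl refl = refl
if-just-embed {c = false} refl refl = refl

stepPerm-embed : ∀ {n} k a b (u : Vec ℕ (suc n)) → a ≤ suc n → b ≤ suc n → k ≤ suc n → Bounded (suc n) u →
                 stepPerm k (a , b) (u ∷ʳ suc (suc n)) ≡ M.map embed (stepPerm k (a , b) u)
stepPerm-embed {n} k a b u a≤N b≤N k≤N u≤N with a <ᵇ b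
... | true = if-just-embed
  (trans (cong₂ (λ z y → covers k (z , u ∷ʳ M) (z , y)) (replicate-∷ʳ n 0) swapped)
         (covers-embed k (replicate n 0 , u) (replicate n 0 , swapVal a b u) k≤N u≤N))
  (cong₂ _,_ (replicate-∷ʳ n 0) swapped)
  where
  M = suc (suc n)
  swapped : swapVal a b (u ∷ʳ M) ≡ swapVal a b u ∷ʳ M
  swapped = swapVal-∷ʳ a b u M (>⇒≢ (s≤s a≤N)) (>⇒≢ (s≤s b≤N))
... | false with b <ᵇ a
...   | false = refl
...   | true  = if-just-embed
  (cong₂ _∧_ (cong₂ _<ᵇ_ i≡ j≡)
             (trans (cong₂ (λ z q → covers k (z , u ∷ʳ M) q) (replicate-∷ʳ n 0) (cong₂ _,_ q≡ swapped))
                    (covers-embed k (replicate n 0 , u) (qExp i j , swapVal a b u) k≤N u≤N)))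
  (cong₂ _,_ q≡ swapped)
  where
  M = suc (suc n)
  i = inv⁻¹ u a
  j = inv⁻¹ u b
  swapped : swapVal a b (u ∷ʳ M) ≡ swapVal a b u ∷ʳ M
  swapped = swapVal-∷ʳ a b u M (>⇒≢ (s≤s a≤N)) (>⇒≢ (s≤s b≤N))
  i≡ : inv⁻¹ (u ∷ʳ M) a ≡ i
  i≡ = inv⁻¹-∷ʳ u M a (>⇒≢ (s≤s a≤N))
  j≡ : inv⁻¹ (u ∷ʳ M) b ≡ j
  j≡ = inv⁻¹-∷ʳ u M b (>⇒≢ (s≤s b≤N))
  q≡ : qExp {suc n} (inv⁻¹ (u ∷ʳ M) a) (inv⁻¹ (u ∷ʳ M) b) ≡ qExp i j ∷ʳ 0
  q≡ = trans (cong₂ qExp i≡ j≡) (trans (qExp-∷ʳ {n} i j) (cong (qExp i j ∷ʳ_) (qExpEntry-≥ i (inv⁻¹≤ u b))))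

BoundedResult : ℕ → Maybe (SNq n) → Set
BoundedResult N = Maybe.All (Bounded N ∘ proj₂)

step-bounded : ∀ {n} k {a b} {x : Maybe (SNq n)} → a ≤ suc n → b ≤ suc n →
               BoundedResult (suc n) x → BoundedResult (suc n) (step k (a , b) x)
step-bounded k a≤N b≤N Maybe.nothing = Maybe.nothing
step-bounded k {a} {b} {just (α , u)} a≤N b≤N (Maybe.just u≤N) with stepPerm k (a , b) u in e
... | nothing      = Maybe.nothing
... | just (β , y) =
  Maybe.just (subst (Bounded _) (sym (proj₁ (stepPerm-just k a b u e))) (swapVal-bounded a b a≤N b≤N u≤N))

act-bounded : ∀ {n} k v {x : Maybe (SNq n)} → SuppIn (suc n) v →
              BoundedResult (suc n) x → BoundedResult (suc n) (act k v x)
act-bounded k []            []                  x≤N = x≤N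
act-bounded k ((a , b) ∷ v) ((a≤N , b≤N) ∷ v≤N) x≤N = step-bounded k a≤N b≤N (act-bounded k v v≤N x≤N)

step-embed : ∀ {n} k a b (x : Maybe (SNq n)) → a ≤ suc n → b ≤ suc n → k ≤ suc n → BoundedResult (suc n) x →
             step k (a , b) (M.map embed x) ≡ M.map embed (step k (a , b) x)
step-embed k a b nothing        a≤N b≤N k≤N _ = refl
step-embed k a b (just (α , u)) a≤N b≤N k≤N (Maybe.just u≤N)
  rewrite stepPerm-embed k a b u a≤N b≤N k≤N u≤N with stepPerm k (a , b) u
... | nothing      = refl
... | just (β , y) = cong (λ γ → just (γ , y ∷ʳ _)) (zipWith-∷ʳ _+_ α β 0 0)

act-embed : ∀ {n} k v (x : Maybe (SNq n)) → k ≤ suc n → SuppIn (suc n) v → BoundedResult (suc n) x →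
            act k v (M.map embed x) ≡ M.map embed (act k v x)
act-embed k []            x k≤N []                  x≤N = refl
act-embed k ((a , b) ∷ v) x k≤N ((a≤N , b≤N) ∷ v≤N) x≤N =
  trans (cong (step k (a , b)) (act-embed k v x k≤N v≤N x≤N))
        (step-embed k a b (act k v x) a≤N b≤N k≤N (act-bounded k v v≤N x≤N))

VanishesAt : Op → ℕ → Set
VanishesAt v n = ∀ (α : Vec ℕ n) (w : Vec ℕ (suc n)) → IsPerm w →
                 ∀ k → 1 ≤ k → k ≤ n → act k v (just (α , w)) ≡ nothing

vanishesAt-embed⁻ : ∀ {n} v → SuppIn (suc n) v → VanishesAt v (suc n) → VanishesAt v n
vanishesAt-embed⁻ v v≤N vanishes α w w↭ k 1≤k k≤n =
  map-embed≡nothing (act k v (just (α , w)))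
    (trans (sym (act-embed k v (just (α , w)) (m≤n⇒m≤1+n k≤n) v≤N (Maybe.just (IsPerm⇒Bounded w w↭))))
           (vanishes (α ∷ʳ 0) (w ∷ʳ _) (IsPerm-∷ʳ w w↭) k 1≤k (m≤n⇒m≤1+n k≤n)))
  where
  map-embed≡nothing : ∀ {n} (x : Maybe (SNq n)) → M.map embed x ≡ nothing → x ≡ nothing
  map-embed≡nothing nothing _ = refl

length≢⇒vanishesAt : ∀ {n} v v′ → v ≋ v′ → length v ≢ length v′ →
                     SuppIn (suc n) v → SuppIn (suc n) v′ → VanishesAt v n
length≢⇒vanishesAt v v′ v≋v′ len≢ v≤N v′≤N α w w↭ k 1≤k k≤n with act k v (just (α , w)) in e
... | nothing = refl
... | just x′ = ⊥-elim (len≢ (+-cancelʳ-≡ (grade (α , w)) (length v) (length v′)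
                  (trans (sym (act-grade k v (α , w) x′ e)) (act-grade k v′ (α , w) x′ e′))))
  where
  e′ : act k v′ (just (α , w)) ≡ just x′
  e′ = trans (sym (v≋v′ _ v≤N v′≤N α w w↭ k 1≤k k≤n)) e

suppMax : Op → ℕ
suppMax []            = 0
suppMax ((a , b) ∷ v) = a ⊔ b ⊔ suppMax v

SuppIn-mono : ∀ {N N′} v → N ≤ N′ → SuppIn N v → SuppIn N′ v
SuppIn-mono []            N≤N′ []                  = []
SuppIn-mono ((a , b) ∷ v) N≤N′ ((a≤N , b≤N) ∷ v≤N) = (≤-trans a≤N N≤N′ , ≤-trans b≤N N≤N′) ∷ SuppIn-mono v N≤N′ v≤N

SuppIn-suppMax : ∀ v → SuppIn (suppMax v) v
SuppIn-suppMax []            = []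
SuppIn-suppMax ((a , b) ∷ v) =
  (≤-trans (m≤m⊔n a b) (m≤m⊔n (a ⊔ b) _) , ≤-trans (m≤n⊔m a b) (m≤m⊔n (a ⊔ b) _))
  ∷ SuppIn-mono v (m≤n⊔m (a ⊔ b) _) (SuppIn-suppMax v)

length≢⇒IsZeroOp : ∀ v v′ → v ≋ v′ → length v ≢ length v′ → IsZeroOp v
length≢⇒IsZeroOp v v′ v≋v′ len≢ n v≤N =
  climb (suppMax v′) n v≤N (SuppIn-mono v′ (m≤n⇒m≤1+n (m≤m+n _ n)) (SuppIn-suppMax v′))
  where
  climb : ∀ d m → SuppIn (suc m) v → SuppIn (suc (d + m)) v′ → VanishesAt v m
  climb zero    m v≤M v′≤M = length≢⇒vanishesAt v v′ v≋v′ len≢ v≤M v′≤M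
  climb (suc d) m v≤M v′≤M = vanishesAt-embed⁻ v v≤M
    (climb d (suc m) (SuppIn-mono v (n≤1+n _) v≤M) (subst (λ l → SuppIn (suc l) v′) (sym (+-suc d m)) v′≤M))

lemma4p7 : (v v' : Op) → WellFormed v → WellFormed v' →
           v ≋ v' → ¬ IsZeroOp v → length v ≡ length v'
lemma4p7 v v' _ _ v≋v' v≢0 = decidable-stable (length v ≟ length v') (v≢0 ∘ length≢⇒IsZeroOp v v' v≋v')
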